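{- If $i\ge2$, then the vincular patterns $1^i3\text{ - }2$ and $13^i\text{ - }2$ are Wilf-equivalent.
   Context: For $k\ge1$ let $[k]=\{1,\dots,k\}$; a $k$-ary word of length $n$ is an element of $[k]^n$. $a^i$ denotes $i$ consecutive copies of the letter $a$. Two words are order-isomorphic if replacing the $i$-th smallest distinct letter by $i$ yields the same word. A vincular pattern $\alpha\text{ - }b$ with $\alpha$ a word of length $m$ and $b$ a single letter occurs in $w=w_1\cdots w_n$ if there are indices $p$ and $q\ge p+m$ with $w_p\cdots w_{p+m-1}w_q$ order-isomorphic to $\alpha b$; otherwise $w$ avoids it. Thus $1^i3\text{ - }2$ has underlying word $1^i32$ and $13^i\text{ - }2$ has underlying word $13^i2$. For a pattern $\sigma$, $a_\sigma(n,k)$ is the number of words in $[k]^n$ avoiding $\sigma$; $\sigma\sim\tau$ (Wilf-equivalence) means $a_\sigma(n,k)=a_\tau(n,k)$ for all $n\ge0,k\ge1$. -}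

module Defs where

open import Data.Nat using (ℕ; zero; suc; _+_; _∸_; _≤_; _<ᵇ_; _≡ᵇ_)
open import Data.Nat.Properties using (_≟_)
open import Data.Bool using (Bool; true; false; _∧_; not)
open import Data.List using (List; []; _∷_; _++_; map; length; take; drop; upTo; filterᵇ; concatMap; replicate)
open import Data.Bool.ListAction using (any)
open import Data.List.Properties using (≡-dec)
open import Relation.Nullary.Decidable using (⌊_⌋)
open import Relation.Binary.PropositionalEquality using (_≡_)

-- Words are lists of natural numbers; a k-ary word uses letters in {1,…,k}.
Word : Set
Word = List ℕ

_∈ᵇ_ : ℕ → Word → Bool
v ∈ᵇ u = any (v ≡ᵇ_) u

-- reduction (standardization): replace the i-th smallest distinct letter by i,
-- i.e. each letter x becomes 1 + #(distinct letters of u smaller than x)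
reduce : Word → Word
reduce u = map (λ x → suc (length (filterᵇ (λ v → v ∈ᵇ u) (upTo x)))) u

orderIsoᵇ : Word → Word → Bool
orderIsoᵇ u v = ⌊ ≡-dec _≟_ (reduce u) (reduce v) ⌋

-- w contains the vincular pattern α-b: there are indices p and q ≥ p + m
-- (0-based, q < |w|, m = |α|) with w_p⋯w_{p+m-1} w_q order-isomorphic to α b.
occursᵇ : Word → ℕ → Word → Bool
occursᵇ α b w =
  any (λ p →
    any (λ q → (p + length α <ᵇ suc q) ∧
               orderIsoᵇ (take (length α) (drop p w) ++ take 1 (drop q w)) (α ++ b ∷ []))
        (upTo (length w)))
    (upTo (length w))

avoidsᵇ : Word → ℕ → Word → Bool
avoidsᵇ α b w = not (occursᵇ α b w)

words : ℕ → ℕ → List Word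
words zero    k = [] ∷ []
words (suc n) k = concatMap (λ a → map (suc a ∷_) (words n k)) (upTo k)

avoidCount : Word → ℕ → ℕ → ℕ → ℕ
avoidCount α b n k = length (filterᵇ (avoidsᵇ α b) (words n k))

WilfEquivalent : Word → ℕ → Word → ℕ → Set
WilfEquivalent α b β c = ∀ (n k : ℕ) → 1 ≤ k → avoidCount α b n k ≡ avoidCount β c n k

-- Split a word into maximal runs y₁^m₁ ⋯ y_ℓ^m_ℓ of equal letters. In an occurrence of 1ⁱ3-2
-- the block 1ⁱ3 must consist of the last i letters of a run y_j followed by the first letter of
-- y_{j+1}; so a word contains 1ⁱ3-2 iff for some j we have m_j ≥ i and a letter of a run after
-- y_{j+1} lies strictly between y_j and y_{j+1}. Likewise it contains 13ⁱ-2 iff the same holds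
-- with m_{j+1} ≥ i in place of m_j. Rotating the run lengths, (m₁, …, m_ℓ) ↦ (m₂, …, m_ℓ, m₁),
-- keeps the letters of the runs, hence is a bijection of [k]ⁿ, and it exchanges the two criteria.
module Submission where

open import Defs
open import Data.Bool using (Bool; true; false; T; not; if_then_else_; _∧_)
open import Data.Bool.ListAction using (any)
open import Data.Bool.Properties using (T-≡; T-∧; ⇔→≡; if-float)
open import Data.Empty using (⊥; ⊥-elim)
open import Data.List using (List; []; _∷_; _++_; _∷ʳ_; map; length; filterᵇ; replicate; upTo; foldr; tails; reverse; drop; take; head; unzip; zip)
open import Data.List.Properties using (length-++; length-map; length-replicate; map-++; map-replicate; map-∘; map-cong; ∷-injectiveˡ; ∷-injectiveʳ; ∷ʳ-injective; ++-assoc; reverse-involutive; reverse-++; unfold-reverse; unzip-zip; zip-unzip; take++drop≡id; drop-drop; upTo-∷ʳ; filter-++; ≡-dec)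
open import Data.List.Membership.Propositional using (_∈_; _∉_; find; lose)
open import Data.List.Membership.Propositional.Properties using (∈-map⁺; ∈-map⁻; ∈-concat⁺′; ∈-concat⁻′; ∈-upTo⁺; ∈-upTo⁻; ∈-++⁺ˡ; ∈-++⁺ʳ; ∈-++⁻; ∈-∃++)
open import Data.List.Membership.Propositional.Properties.WithK using (unique∧set⇒bag)
open import Data.List.Relation.Binary.BagAndSetEquality using (∼bag⇒↭)
open import Data.List.Relation.Binary.Permutation.Propositional using (_↭_; ↭-refl; ↭-sym; ↭-trans)
open import Data.List.Relation.Binary.Permutation.Propositional.Properties using (filter-↭; ↭-length; ↭-reverse; ∷↭∷ʳ; map⁺)
open import Data.List.Relation.Unary.All as All using (All; []; _∷_)
import Data.List.Relation.Unary.All.Properties as Allₚ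
import Data.List.Relation.Unary.AllPairs as AllPairs
import Data.List.Relation.Unary.AllPairs.Properties as AllPairsₚ
open import Data.List.Relation.Unary.Any as Any using (Any; here; there)
open import Data.List.Relation.Unary.Any.Properties using (any⁺; any⁻)
open import Data.List.Relation.Unary.Linked as Linked using (Linked; []; [-]; _∷_)
open import Data.List.Relation.Unary.Unique.Propositional using (Unique)
import Data.List.Relation.Unary.Unique.Propositional.Properties as Unique
open import Data.Maybe using (just)
open import Data.Maybe.Properties using (just-injective)
open import Data.Nat using (ℕ; zero; suc; _+_; _∸_; _≤_; _<_; _<ᵇ_; z≤n; s≤s; s≤s⁻¹; _≤′_; ≤′-refl; ≤′-step)
open import Data.Nat.ListAction using (sum)
open import Data.Nat.ListAction.Properties using (sum-↭)
open import Data.Nat.Properties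
open import Data.Product using (∃-syntax; _×_; _,_; proj₁; proj₂)
open import Data.Sum using (_⊎_; inj₁; inj₂; [_,_]′)
open import Data.Sum.Function.Propositional using (_⊎-⇔_)
open import Data.Unit using (tt)
open import Function using (_∘_; _⇔_; mk⇔; Equivalence)
open import Function.Construct.Composition using () renaming (equivalence to ⇔-trans)
open import Function.Construct.Symmetry using (⇔-sym)
open import Function.Properties.Equivalence using (⇔-setoid)
open import Level using (0ℓ)
open import Relation.Binary.Definitions using (tri<; tri≈; tri>)
open import Relation.Binary.PropositionalEquality using (_≡_; _≢_; refl; sym; trans; cong; cong₂; subst; subst₂; module ≡-Reasoning)
import Relation.Binary.Reasoning.Setoid as SetoidReasoning
open import Relation.Nullary using (¬_; Dec; yes; no)
open import Relation.Nullary.Decidable using (T?; toWitness; fromWitness)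

module _ {A B : Set} where

  length-filterᵇ-map : (p : A → Bool) (q : B → Bool) (f : A → B) → (∀ x → p x ≡ q (f x)) →
                       ∀ xs → length (filterᵇ p xs) ≡ length (filterᵇ q (map f xs))
  length-filterᵇ-map p q f p≡q∘f []       = refl
  length-filterᵇ-map p q f p≡q∘f (x ∷ xs) with p x | q (f x) | p≡q∘f x
  ... | true  | .true  | refl = cong suc (length-filterᵇ-map p q f p≡q∘f xs)
  ... | false | .false | refl = length-filterᵇ-map p q f p≡q∘f xs

module _ {A : Set} (L : List A) (unique : Unique L) (f g : A → A)
         (g∘f : ∀ x → g (f x) ≡ x) (f∘g : ∀ x → f (g x) ≡ x)
         (f-closed : ∀ {x} → x ∈ L → f x ∈ L) (g-closed : ∀ {x} → x ∈ L → g x ∈ L) where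

  map-bijection-↭ : map f L ↭ L
  map-bijection-↭ = ∼bag⇒↭ (unique∧set⇒bag (Unique.map⁺ f-injective unique) unique (mk⇔ to from))
    where
    f-injective : ∀ {x y} → f x ≡ f y → x ≡ y
    f-injective {x} {y} fx≡fy = trans (sym (g∘f x)) (trans (cong g fx≡fy) (g∘f y))
    to : ∀ {y} → y ∈ map f L → y ∈ L
    to y∈ with ∈-map⁻ f y∈
    ... | x , x∈ , refl = f-closed x∈
    from : ∀ {y} → y ∈ L → y ∈ map f L
    from {y} y∈ = subst (_∈ map f L) (f∘g y) (∈-map⁺ f (g-closed y∈))

  length-filterᵇ-bijection : (p q : A → Bool) → (∀ x → p x ≡ q (f x)) →
                             length (filterᵇ p L) ≡ length (filterᵇ q L)
  length-filterᵇ-bijection p q p≡q∘f =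
    trans (length-filterᵇ-map p q f p≡q∘f L) (↭-length (filter-↭ (T? ∘ q) map-bijection-↭))

module _ {A : Set} where

  map-injectiveOn : ∀ {B : Set} (g : A → B) {S : List A} →
                    (∀ {x y} → x ∈ S → y ∈ S → g x ≡ g y → x ≡ y) →
                    ∀ {xs ys} → All (_∈ S) xs → All (_∈ S) ys → map g xs ≡ map g ys → xs ≡ ys
  map-injectiveOn g inj []           []           _  = refl
  map-injectiveOn g inj (x∈ ∷ xs⊆S) (y∈ ∷ ys⊆S) eq =
    cong₂ _∷_ (inj x∈ y∈ (∷-injectiveˡ eq)) (map-injectiveOn g inj xs⊆S ys⊆S (∷-injectiveʳ eq))

  take-length-++ : ∀ (xs : List A) {ys} → take (length xs) (xs ++ ys) ≡ xs
  take-length-++ []       = refl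
  take-length-++ (x ∷ xs) = cong (x ∷_) (take-length-++ xs)

  drop-length-++ : ∀ (xs : List A) {ys} → drop (length xs) (xs ++ ys) ≡ ys
  drop-length-++ []       = refl
  drop-length-++ (x ∷ xs) = drop-length-++ xs

  drop-<-length : ∀ n (xs : List A) → n < length xs → ∃[ y ] ∃[ ys ] drop n xs ≡ y ∷ ys
  drop-<-length zero    (x ∷ xs) _         = x , xs , refl
  drop-<-length (suc n) (x ∷ xs) (s≤s n<) = drop-<-length n xs n<

  drop≡∷⇒< : ∀ n (xs : List A) {y ys} → drop n xs ≡ y ∷ ys → n < length xs
  drop≡∷⇒< zero    (x ∷ xs) _  = s≤s z≤n
  drop≡∷⇒< (suc n) (x ∷ xs) eq = s≤s (drop≡∷⇒< n xs eq)

  replicate-+ : ∀ m n (x : A) → replicate (m + n) x ≡ replicate m x ++ replicate n x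
  replicate-+ zero    n x = refl
  replicate-+ (suc m) n x = cong (x ∷_) (replicate-+ m n x)

  ∈-replicate⁻ : ∀ n {x y : A} → y ∈ replicate n x → y ≡ x
  ∈-replicate⁻ n {x} y∈ = All.lookup (Allₚ.replicate⁺ {P = _≡ x} n refl) y∈

  ∈-replicate-++⁻ : ∀ n {x y : A} {xs} → y ∈ replicate n x ++ xs → y ≢ x → y ∈ xs
  ∈-replicate-++⁻ n y∈ y≢x with ∈-++⁻ (replicate n _) y∈
  ... | inj₁ y∈run = ⊥-elim (y≢x (∈-replicate⁻ n y∈run))
  ... | inj₂ y∈xs  = y∈xs

  rotateˡ : List A → List A
  rotateˡ []       = []
  rotateˡ (x ∷ xs) = xs ∷ʳ x

  rotateʳ : List A → List A
  rotateʳ xs = reverse (rotateˡ (reverse xs))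

  rotateʳ-∷ʳ : ∀ xs x → rotateʳ (xs ∷ʳ x) ≡ x ∷ xs
  rotateʳ-∷ʳ xs x = begin
    reverse (rotateˡ (reverse (xs ∷ʳ x)))  ≡⟨ cong (reverse ∘ rotateˡ) (reverse-++ xs (x ∷ [])) ⟩
    reverse (reverse xs ∷ʳ x)              ≡⟨ reverse-++ (reverse xs) (x ∷ []) ⟩
    x ∷ reverse (reverse xs)               ≡⟨ cong (x ∷_) (reverse-involutive xs) ⟩
    x ∷ xs                                 ∎
    where open ≡-Reasoning

  rotateʳ-rotateˡ : ∀ xs → rotateʳ (rotateˡ xs) ≡ xs
  rotateʳ-rotateˡ []       = refl
  rotateʳ-rotateˡ (x ∷ xs) = rotateʳ-∷ʳ xs x

  rotateˡ-rotateʳ : ∀ xs → rotateˡ (rotateʳ xs) ≡ xs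
  rotateˡ-rotateʳ xs = subst (λ ys → rotateˡ (rotateʳ ys) ≡ ys) (reverse-involutive xs) (go (reverse xs))
    where
    go : ∀ ys → rotateˡ (rotateʳ (reverse ys)) ≡ reverse ys
    go []       = refl
    go (y ∷ ys) = begin
      rotateˡ (rotateʳ (reverse (y ∷ ys)))  ≡⟨ cong (rotateˡ ∘ rotateʳ) (unfold-reverse y ys) ⟩
      rotateˡ (rotateʳ (reverse ys ∷ʳ y))   ≡⟨ cong rotateˡ (rotateʳ-∷ʳ (reverse ys) y) ⟩
      reverse ys ∷ʳ y                       ≡⟨ unfold-reverse y ys ⟨
      reverse (y ∷ ys)                      ∎
      where open ≡-Reasoning

  rotateˡ-↭ : ∀ xs → rotateˡ xs ↭ xs
  rotateˡ-↭ []       = ↭-refl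
  rotateˡ-↭ (x ∷ xs) = ↭-sym (∷↭∷ʳ x xs)

  rotateʳ-↭ : ∀ xs → rotateʳ xs ↭ xs
  rotateʳ-↭ xs = ↭-trans (↭-reverse _) (↭-trans (rotateˡ-↭ (reverse xs)) (↭-reverse xs))

  Any-⇔ : ∀ {P Q : A → Set} → (∀ x → P x ⇔ Q x) → ∀ {xs} → Any P xs ⇔ Any Q xs
  Any-⇔ P⇔Q = mk⇔ (Any.map (Equivalence.to (P⇔Q _))) (Any.map (Equivalence.from (P⇔Q _)))

  module _ {P : List A → Set} where

    Any-tails⁻ : ∀ w → Any P (tails w) → ∃[ p ] P (drop p w)
    Any-tails⁻ []      (here P[]) = 0 , P[]
    Any-tails⁻ (x ∷ w) (here Pw)  = 0 , Pw
    Any-tails⁻ (x ∷ w) (there a)  = let p , Pp = Any-tails⁻ w a in suc p , Pp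

    Any-tails⁺ : ∀ p w → P (drop p w) → Any P (tails w)
    Any-tails⁺ zero    w       Pw = here Pw
    Any-tails⁺ (suc p) []      Pp = here Pp
    Any-tails⁺ (suc p) (x ∷ w) Pp = there (Any-tails⁺ p w Pp)

    Any-tails-++⁺ : ∀ xs {ys} → Any P (tails ys) → Any P (tails (xs ++ ys))
    Any-tails-++⁺ []       any = any
    Any-tails-++⁺ (x ∷ xs) any = there (Any-tails-++⁺ xs any)

    Any-tails-replicate-++⇔ : ∀ r {y D} → Any P (tails (replicate (suc r) y ++ D)) ⇔
                                         ((∃[ j ] j ≤ r × P (replicate (suc j) y ++ D)) ⊎ Any P (tails D))
    Any-tails-replicate-++⇔ r {y} {D} = mk⇔ (to r) from
      where
      Starts : ℕ → Set
      Starts r = ∃[ j ] j ≤ r × P (replicate (suc j) y ++ D)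
      to : ∀ r → Any P (tails (replicate (suc r) y ++ D)) → Starts r ⊎ Any P (tails D)
      to r       (here p)    = inj₁ (r , ≤-refl , p)
      to zero    (there any) = inj₂ any
      to (suc r) (there any) with to r any
      ... | inj₁ (j , j≤r , p) = inj₁ (j , m≤n⇒m≤1+n j≤r , p)
      ... | inj₂ any′          = inj₂ any′
      within : ∀ {j r} → j ≤′ r → P (replicate (suc j) y ++ D) → Any P (tails (replicate (suc r) y ++ D))
      within ≤′-refl        p = here p
      within (≤′-step j≤′r) p = there (within j≤′r p)
      from : Starts r ⊎ Any P (tails D) → Any P (tails (replicate (suc r) y ++ D))
      from (inj₁ (j , j≤r , p)) = within (≤⇒≤′ j≤r) p
      from (inj₂ any)           = Any-tails-++⁺ (replicate (suc r) y) any

T-any-upTo : ∀ (f : ℕ → Bool) n → T (any f (upTo n)) ⇔ (∃[ p ] p < n × T (f p))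
T-any-upTo f n = mk⇔ (λ t → let p , p∈ , fp = find (any⁻ f (upTo n) t) in p , ∈-upTo⁻ p∈ , fp)
                     (λ (p , p<n , fp) → any⁺ f (lose (∈-upTo⁺ p<n) fp))

T-⇔⇒≡ : ∀ {x y} → T x ⇔ T y → x ≡ y
T-⇔⇒≡ T⇔T = ⇔→≡ (⇔-trans (⇔-sym T-≡) (⇔-trans T⇔T T-≡))

IsLetter : ℕ → ℕ → Set
IsLetter k x = 1 ≤ x × x ≤ k

∈-words⁻ : ∀ n k {w} → w ∈ words n k → length w ≡ n × All (IsLetter k) w
∈-words⁻ zero    k (here refl) = refl , []
∈-words⁻ (suc n) k w∈ with ∈-concat⁻′ (map (λ a → map (suc a ∷_) (words n k)) (upTo k)) w∈
... | ws , w∈ws , ws∈ with ∈-map⁻ (λ a → map (suc a ∷_) (words n k)) ws∈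
... | a , a∈ , refl with ∈-map⁻ (suc a ∷_) w∈ws
... | v , v∈ , refl with ∈-words⁻ n k v∈
... | |v|≡n , in-range = cong suc |v|≡n , (s≤s z≤n , ∈-upTo⁻ a∈) ∷ in-range

∈-words⁺ : ∀ n k {w} → length w ≡ n → All (IsLetter k) w → w ∈ words n k
∈-words⁺ zero    k {[]}        _    _                  = here refl
∈-words⁺ (suc n) k {suc a ∷ w} |w|≡ ((_ , a<k) ∷ in-range) =
  ∈-concat⁺′ (∈-map⁺ (suc a ∷_) (∈-words⁺ n k (suc-injective |w|≡) in-range))
             (∈-map⁺ (λ a → map (suc a ∷_) (words n k)) (∈-upTo⁺ a<k))

words-unique : ∀ n k → Unique (words n k)
words-unique zero    k = [] AllPairs.∷ AllPairs.[]
words-unique (suc n) k =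
  Unique.concat⁺ (All.tabulate unique-block) (AllPairsₚ.map⁺ (AllPairs.map disjoint (Unique.upTo⁺ k)))
  where
  block : ℕ → List Word
  block a = map (suc a ∷_) (words n k)
  unique-block : ∀ {ws} → ws ∈ map block (upTo k) → Unique ws
  unique-block ws∈ with ∈-map⁻ block ws∈
  ... | a , _ , refl = Unique.map⁺ (λ { refl → refl }) (words-unique n k)
  disjoint : ∀ {a b} → a ≢ b → ∀ {w} → ¬ (w ∈ block a × w ∈ block b)
  disjoint a≢b (w∈a , w∈b) with ∈-map⁻ _ w∈a | ∈-map⁻ _ w∈b
  ... | _ , _ , refl | _ , _ , refl = a≢b refl

words-closed : (f : Word → Word) → (∀ w → length (f w) ≡ length w) →
               (∀ {P : ℕ → Set} {w} → All P w → All P (f w)) →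
               ∀ n k {w} → w ∈ words n k → f w ∈ words n k
words-closed f length-f All-f n k w∈ with ∈-words⁻ n k w∈
... | |w|≡n , in-range = ∈-words⁺ n k (trans (length-f _) |w|≡n) (All-f in-range)

-- Run-length encoding

-- A run (x , r) stands for the r + 1 letters x ⋯ x; so no run is empty.
Run : Set
Run = ℕ × ℕ

Runs : Set
Runs = List Run

letters : Runs → List ℕ
letters R = proj₁ (unzip R)

lengths : Runs → List ℕ
lengths R = proj₂ (unzip R)

decode : Runs → Word
decode []            = []
decode ((x , r) ∷ R) = replicate (suc r) x ++ decode R

consLetter : ℕ → Runs → Runs
consLetter x [] = (x , 0) ∷ []
consLetter x ((y , r) ∷ R) with x ≟ y
... | yes _ = (y , suc r) ∷ R
... | no  _ = (x , 0) ∷ (y , r) ∷ R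

encode : Word → Runs
encode = foldr consLetter []

Maximal : Runs → Set
Maximal R = Linked _≢_ (letters R)

decode-consLetter : ∀ x R → decode (consLetter x R) ≡ x ∷ decode R
decode-consLetter x [] = refl
decode-consLetter x ((y , r) ∷ R) with x ≟ y
... | yes refl = refl
... | no  _    = refl

decode-encode : ∀ w → decode (encode w) ≡ w
decode-encode []      = refl
decode-encode (x ∷ w) = trans (decode-consLetter x (encode w)) (cong (x ∷_) (decode-encode w))

consLetter-maximal : ∀ x R → Maximal R → Maximal (consLetter x R)
consLetter-maximal x [] _ = [-]
consLetter-maximal x ((y , r) ∷ R) maximal with x ≟ y
... | yes refl = maximal
... | no  x≢y  = x≢y ∷ maximal

encode-maximal : ∀ w → Maximal (encode w)
encode-maximal []      = []
encode-maximal (x ∷ w) = consLetter-maximal x (encode w) (encode-maximal w)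

consLetter-fresh : ∀ x R → Linked _≢_ (x ∷ letters R) → consLetter x R ≡ (x , 0) ∷ R
consLetter-fresh x [] _ = refl
consLetter-fresh x ((y , r) ∷ R) (x≢y ∷ _) with x ≟ y
... | yes x≡y = ⊥-elim (x≢y x≡y)
... | no  _   = refl

consLetter-same : ∀ x r R → consLetter x ((x , r) ∷ R) ≡ (x , suc r) ∷ R
consLetter-same x r R with x ≟ x
... | yes _   = refl
... | no  x≢x = ⊥-elim (x≢x refl)

encode-decode : ∀ R → Maximal R → encode (decode R) ≡ R
encode-decode []            _       = refl
encode-decode ((x , r) ∷ R) maximal = encode-run r
  where
  encode-run : ∀ r → encode (replicate (suc r) x ++ decode R) ≡ (x , r) ∷ R
  encode-run zero    = trans (cong (consLetter x) (encode-decode R (Linked.tail maximal)))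
                             (consLetter-fresh x R maximal)
  encode-run (suc r) = trans (cong (consLetter x) (encode-run r)) (consLetter-same x r R)

∈-decode⁻ : ∀ R {b} → b ∈ decode R → b ∈ letters R
∈-decode⁻ ((x , r) ∷ R) b∈ with ∈-++⁻ (replicate (suc r) x) b∈
... | inj₁ b∈run = here (∈-replicate⁻ (suc r) b∈run)
... | inj₂ b∈R   = there (∈-decode⁻ R b∈R)

∈-decode⁺ : ∀ R {b} → b ∈ letters R → b ∈ decode R
∈-decode⁺ ((x , r) ∷ R) (here refl) = here refl
∈-decode⁺ ((x , r) ∷ R) (there b∈)  = ∈-++⁺ʳ (replicate (suc r) x) (∈-decode⁺ R b∈)

All-decode⇔ : ∀ {P : ℕ → Set} R → All P (decode R) ⇔ All P (letters R)
All-decode⇔ R = mk⇔ (λ all → All.tabulate (All.lookup all ∘ ∈-decode⁺ R))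
                    (λ all → All.tabulate (All.lookup all ∘ ∈-decode⁻ R))

length-decode : ∀ R → length (decode R) ≡ sum (map suc (lengths R))
length-decode []            = refl
length-decode ((x , r) ∷ R) =
  trans (length-++ (replicate (suc r) x)) (cong₂ _+_ (length-replicate (suc r)) (length-decode R))

length-letters : ∀ R → length (letters R) ≡ length (lengths R)
length-letters []      = refl
length-letters (_ ∷ R) = cong suc (length-letters R)

relength : (List ℕ → List ℕ) → Runs → Runs
relength h R = zip (letters R) (h (lengths R))

relengthWord : (List ℕ → List ℕ) → Word → Word
relengthWord h w = decode (relength h (encode w))

module PermutedLengths (h : List ℕ → List ℕ) (h-↭ : ∀ xs → h xs ↭ xs) where

  unzip-relength : ∀ R → unzip (relength h R) ≡ (letters R , h (lengths R))
  unzip-relength R =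
    unzip-zip (letters R) (h (lengths R)) (trans (length-letters R) (sym (↭-length (h-↭ (lengths R)))))

  letters-relength : ∀ R → letters (relength h R) ≡ letters R
  letters-relength R = cong proj₁ (unzip-relength R)

  lengths-relength : ∀ R → lengths (relength h R) ≡ h (lengths R)
  lengths-relength R = cong proj₂ (unzip-relength R)

  relength-maximal : ∀ R → Maximal R → Maximal (relength h R)
  relength-maximal R = subst (Linked _≢_) (sym (letters-relength R))

  relength-encode-maximal : ∀ w → Maximal (relength h (encode w))
  relength-encode-maximal w = relength-maximal (encode w) (encode-maximal w)

  length-relengthWord : ∀ w → length (relengthWord h w) ≡ length w
  length-relengthWord w = begin
    length (decode (relength h R))              ≡⟨ length-decode (relength h R) ⟩
    sum (map suc (lengths (relength h R)))      ≡⟨ cong (sum ∘ map suc) (lengths-relength R) ⟩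
    sum (map suc (h (lengths R)))               ≡⟨ sum-↭ (map⁺ suc (h-↭ (lengths R))) ⟩
    sum (map suc (lengths R))                   ≡⟨ length-decode R ⟨
    length (decode R)                           ≡⟨ cong length (decode-encode w) ⟩
    length w                                    ∎
    where
    R : Runs
    R = encode w
    open ≡-Reasoning

  All-relengthWord : ∀ {P : ℕ → Set} {w} → All P w → All P (relengthWord h w)
  All-relengthWord {P} {w} all =
    Equivalence.from (All-decode⇔ (relength h R))
      (subst (All P) (sym (letters-relength R))
        (Equivalence.to (All-decode⇔ R) (subst (All P) (sym (decode-encode w)) all)))
    where
    R : Runs
    R = encode w

relengthWord-inverse : ∀ h₁ h₂ → (∀ xs → h₁ xs ↭ xs) → (∀ xs → h₂ (h₁ xs) ≡ xs) →
                       ∀ w → relengthWord h₂ (relengthWord h₁ w) ≡ w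
relengthWord-inverse h₁ h₂ h₁-↭ h₂∘h₁ w = begin
  decode (relength h₂ (encode (decode (relength h₁ R))))
    ≡⟨ cong (decode ∘ relength h₂) (encode-decode (relength h₁ R) (relength-encode-maximal w)) ⟩
  decode (zip (letters (relength h₁ R)) (h₂ (lengths (relength h₁ R))))
    ≡⟨ cong₂ (λ ls rs → decode (zip ls (h₂ rs))) (letters-relength R) (lengths-relength R) ⟩
  decode (zip (letters R) (h₂ (h₁ (lengths R))))
    ≡⟨ cong (decode ∘ zip (letters R)) (h₂∘h₁ (lengths R)) ⟩
  decode (zip (letters R) (lengths R))       ≡⟨ cong decode (zip-unzip R) ⟩
  decode R                                   ≡⟨ decode-encode w ⟩
  w                                          ∎
  where
  R : Runs
  R = encode w
  open ≡-Reasoning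
  open PermutedLengths h₁ h₁-↭

-- Ranks and the reduction of two-valued patterns

T-∈ᵇ⇔∈ : ∀ x u → T (x ∈ᵇ u) ⇔ x ∈ u
T-∈ᵇ⇔∈ x u = mk⇔ (Any.map (≡ᵇ⇒≡ x _) ∘ any⁻ _ u) (any⁺ _ ∘ Any.map (≡⇒≡ᵇ x _))

rank : Word → ℕ → ℕ
rank u x = length (filterᵇ (_∈ᵇ u) (upTo x))

rank-suc : ∀ u x → rank u (suc x) ≡ rank u x + length (filterᵇ (_∈ᵇ u) (x ∷ []))
rank-suc u x = begin
  length (filterᵇ p (upTo (suc x)))                   ≡⟨ cong (length ∘ filterᵇ p) (upTo-∷ʳ x) ⟨
  length (filterᵇ p (upTo x ∷ʳ x))
    ≡⟨ cong length (filter-++ (T? ∘ p) (upTo x) (x ∷ [])) ⟩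
  length (filterᵇ p (upTo x) ++ filterᵇ p (x ∷ []))   ≡⟨ length-++ (filterᵇ p (upTo x)) ⟩
  rank u x + length (filterᵇ p (x ∷ []))              ∎
  where
  p = _∈ᵇ u
  open ≡-Reasoning

rank-suc-∈ : ∀ u {x} → x ∈ u → rank u (suc x) ≡ suc (rank u x)
rank-suc-∈ u {x} x∈u with x ∈ᵇ u in eq | rank-suc u x
... | true  | step = trans step (+-comm (rank u x) 1)
... | false | _    = ⊥-elim (subst T eq (Equivalence.from (T-∈ᵇ⇔∈ x u) x∈u))

rank-suc-∉ : ∀ u {x} → x ∉ u → rank u (suc x) ≡ rank u x
rank-suc-∉ u {x} x∉u with x ∈ᵇ u in eq | rank-suc u x
... | false | step = trans step (+-identityʳ (rank u x))
... | true  | _    = ⊥-elim (x∉u (Equivalence.to (T-∈ᵇ⇔∈ x u) (subst T (sym eq) tt)))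

rank-mono : ∀ u {x y} → x ≤ y → rank u x ≤ rank u y
rank-mono u {x} x≤y = go (≤⇒≤′ x≤y)
  where
  go : ∀ {y} → x ≤′ y → rank u x ≤ rank u y
  go ≤′-refl        = ≤-refl
  go (≤′-step x≤′y) = ≤-trans (go x≤′y) (≤-trans (m≤m+n _ _) (≤-reflexive (sym (rank-suc u _))))

rank-constant : ∀ u {x z} → (∀ {y} → x ≤ y → y < z → y ∉ u) → x ≤ z → rank u z ≡ rank u x
rank-constant u {x} absent x≤z = go (≤⇒≤′ x≤z) absent
  where
  go : ∀ {z} → x ≤′ z → (∀ {y} → x ≤ y → y < z → y ∉ u) → rank u z ≡ rank u x
  go ≤′-refl                   _      = refl
  go (≤′-step {z} x≤′z) absent =
    trans (rank-suc-∉ u (absent (≤′⇒≤ x≤′z) ≤-refl))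
          (go x≤′z (λ x≤y y<z → absent x≤y (m≤n⇒m≤1+n y<z)))

rank-monoˡ-< : ∀ u {x y} → x ∈ u → x < y → rank u x < rank u y
rank-monoˡ-< u x∈u x<y = ≤-trans (≤-reflexive (sym (rank-suc-∈ u x∈u))) (rank-mono u x<y)

rank-cancel-< : ∀ u {x y} → rank u x < rank u y → x < y
rank-cancel-< u {x} {y} rx<ry = ≰⇒> (λ y≤x → <⇒≱ rx<ry (rank-mono u y≤x))

rank-injective : ∀ u {x y} → x ∈ u → y ∈ u → rank u x ≡ rank u y → x ≡ y
rank-injective u {x} {y} x∈u y∈u rx≡ry with <-cmp x y
... | tri< x<y _ _ = ⊥-elim (<⇒≢ (rank-monoˡ-< u x∈u x<y) rx≡ry)
... | tri≈ _ x≡y _ = x≡y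
... | tri> _ _ y<x = ⊥-elim (<⇒≢ (rank-monoˡ-< u y∈u y<x) (sym rx≡ry))

rank-three : ∀ u {a v c} → a < v → v < c → a ∈ u → v ∈ u →
             (∀ {y} → y ∈ u → y ≡ a ⊎ y ≡ v ⊎ y ≡ c) →
             rank u a ≡ 0 × rank u v ≡ 1 × rank u c ≡ 2
rank-three u {a} {v} {c} a<v v<c a∈u v∈u only = rank-a , rank-v , rank-c
  where
  absent : ∀ {y} → y ≢ a → y ≢ v → y ≢ c → y ∉ u
  absent y≢a y≢v y≢c y∈u with only y∈u
  ... | inj₁ y≡a        = y≢a y≡a
  ... | inj₂ (inj₁ y≡v) = y≢v y≡v
  ... | inj₂ (inj₂ y≡c) = y≢c y≡c
  rank-a : rank u a ≡ 0
  rank-a = rank-constant u (λ _ y<a → absent (<⇒≢ y<a) (<⇒≢ (<-trans y<a a<v))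
                                              (<⇒≢ (<-trans y<a (<-trans a<v v<c)))) z≤n
  rank-v : rank u v ≡ 1
  rank-v = begin
    rank u v
      ≡⟨ rank-constant u (λ a<y y<v → absent (>⇒≢ a<y) (<⇒≢ y<v) (<⇒≢ (<-trans y<v v<c))) a<v ⟩
    rank u (suc a)  ≡⟨ rank-suc-∈ u a∈u ⟩
    suc (rank u a)  ≡⟨ cong suc rank-a ⟩
    1               ∎
    where open ≡-Reasoning
  rank-c : rank u c ≡ 2
  rank-c = begin
    rank u c
      ≡⟨ rank-constant u (λ v<y y<c → absent (>⇒≢ (<-trans a<v v<y)) (>⇒≢ v<y) (<⇒≢ y<c)) v<c ⟩
    rank u (suc v)  ≡⟨ rank-suc-∈ u v∈u ⟩
    suc (rank u v)  ≡⟨ cong suc rank-v ⟩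
    2               ∎
    where open ≡-Reasoning

-- A template marks each position of a pattern over two letters as low (false) or high (true).
instantiate : ℕ → ℕ → List Bool → Word
instantiate a c = map (λ b → if b then c else a)

map-instantiate : ∀ (g : ℕ → ℕ) a c t → map g (instantiate a c t) ≡ instantiate (g a) (g c) t
map-instantiate g a c t = trans (sym (map-∘ t)) (map-cong (λ b → if-float g b) t)

∈-instantiate⁻ : ∀ {a c y} t → y ∈ instantiate a c t → y ≡ a ⊎ y ≡ c
∈-instantiate⁻ t y∈ with ∈-map⁻ _ y∈
... | false , _ , y≡a = inj₁ y≡a
... | true  , _ , y≡c = inj₂ y≡c

reduce-instantiate : ∀ {t} → false ∈ t → ∀ {a v c} → a < v → v < c →
                     reduce (instantiate a c t ++ v ∷ []) ≡ instantiate 1 3 t ++ 2 ∷ []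
reduce-instantiate {t} low {a} {v} {c} a<v v<c = begin
  map ρ (instantiate a c t ++ v ∷ [])    ≡⟨ map-++ ρ (instantiate a c t) (v ∷ []) ⟩
  map ρ (instantiate a c t) ++ ρ v ∷ []  ≡⟨ cong (_++ ρ v ∷ []) (map-instantiate ρ a c t) ⟩
  instantiate (ρ a) (ρ c) t ++ ρ v ∷ []
    ≡⟨ cong₂ (λ x z → instantiate x z t ++ ρ v ∷ []) (cong suc rank-a) (cong suc rank-c) ⟩
  instantiate 1 3 t ++ ρ v ∷ []          ≡⟨ cong (λ y → instantiate 1 3 t ++ suc y ∷ []) rank-v ⟩
  instantiate 1 3 t ++ 2 ∷ []            ∎
  where
  open ≡-Reasoning
  u : Word
  u = instantiate a c t ++ v ∷ []
  ρ : ℕ → ℕ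
  ρ = suc ∘ rank u
  only : ∀ {y} → y ∈ u → y ≡ a ⊎ y ≡ v ⊎ y ≡ c
  only y∈u with ∈-++⁻ (instantiate a c t) y∈u
  ... | inj₁ y∈ac with ∈-instantiate⁻ t y∈ac
  ...   | inj₁ y≡a = inj₁ y≡a
  ...   | inj₂ y≡c = inj₂ (inj₂ y≡c)
  only y∈u | inj₂ (here y≡v) = inj₂ (inj₁ y≡v)
  ranks : rank u a ≡ 0 × rank u v ≡ 1 × rank u c ≡ 2
  ranks = rank-three u a<v v<c (∈-++⁺ˡ (∈-map⁺ _ low)) (∈-++⁺ʳ _ (here refl)) only
  rank-a : rank u a ≡ 0
  rank-a = proj₁ ranks
  rank-v : rank u v ≡ 1
  rank-v = proj₁ (proj₂ ranks)
  rank-c : rank u c ≡ 2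
  rank-c = proj₂ (proj₂ ranks)

module _ {t : List Bool} (low : false ∈ t) (high : true ∈ t) (u : Word) (v : ℕ) where
  private
    ws : Word
    ws = u ++ v ∷ []
    ρ : ℕ → ℕ
    ρ = suc ∘ rank ws
    u⊆ws : All (_∈ ws) u
    u⊆ws = All.tabulate ∈-++⁺ˡ
    split : reduce ws ≡ instantiate 1 3 t ++ 2 ∷ [] → map ρ u ≡ instantiate 1 3 t × ρ v ≡ 2
    split eq = ∷ʳ-injective (map ρ u) (instantiate 1 3 t) (trans (sym (map-++ ρ u (v ∷ []))) eq)

  reduce≡instantiate⁻ : reduce (u ++ v ∷ []) ≡ instantiate 1 3 t ++ 2 ∷ [] →
                        ∃[ a ] ∃[ c ] u ≡ instantiate a c t × a < v × v < c
  reduce≡instantiate⁻ eq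
    with ∈-map⁻ ρ (subst (1 ∈_) (sym (proj₁ (split eq))) (∈-map⁺ _ low))
       | ∈-map⁻ ρ (subst (3 ∈_) (sym (proj₁ (split eq))) (∈-map⁺ _ high))
  ... | a , a∈u , 1≡ρa | c , c∈u , 3≡ρc = a , c , u≡ , rank-cancel-< ws ra<rv , rank-cancel-< ws rv<rc
    where
    ρv≡2 : ρ v ≡ 2
    ρv≡2 = proj₂ (split eq)
    ac⊆ws : All (_∈ ws) (instantiate a c t)
    ac⊆ws = All.tabulate λ y∈ →
      [ (λ { refl → All.lookup u⊆ws a∈u }) , (λ { refl → All.lookup u⊆ws c∈u }) ]′ (∈-instantiate⁻ t y∈)
    u≡ : u ≡ instantiate a c t
    u≡ = map-injectiveOn ρ (λ x∈ y∈ → rank-injective ws x∈ y∈ ∘ suc-injective) u⊆ws ac⊆ws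
           (trans (proj₁ (split eq)) (trans (cong₂ (λ x z → instantiate x z t) 1≡ρa 3≡ρc)
                                            (sym (map-instantiate ρ a c t))))
    ra<rv : rank ws a < rank ws v
    ra<rv = subst₂ _<_ (suc-injective 1≡ρa) (sym (suc-injective ρv≡2)) (s≤s z≤n)
    rv<rc : rank ws v < rank ws c
    rv<rc = subst₂ _<_ (sym (suc-injective ρv≡2)) (suc-injective 3≡ρc) (s≤s (s≤s z≤n))

T-orderIsoᵇ⇔ : ∀ u v → T (orderIsoᵇ u v) ⇔ reduce u ≡ reduce v
T-orderIsoᵇ⇔ u v = mk⇔ (toWitness {a? = dec}) (fromWitness {a? = dec})
  where
  dec : Dec (reduce u ≡ reduce v)
  dec = ≡-dec _≟_ (reduce u) (reduce v)

record VincularMatch (α : Word) (b : ℕ) (s : Word) : Set where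
  constructor vincularMatch
  field
    {block middle rest} : Word
    {last}              : ℕ
    split               : s ≡ block ++ middle ++ last ∷ rest
    order-isomorphic    : reduce (block ++ last ∷ []) ≡ reduce (α ++ b ∷ [])

IndexedMatch : Word → ℕ → Word → ℕ → ℕ → Set
IndexedMatch α b w p q =
  p + length α ≤ q × reduce (take (length α) (drop p w) ++ take 1 (drop q w)) ≡ reduce (α ++ b ∷ [])

module _ (α : Word) (b : ℕ) where

  private
    m : ℕ
    m = length α
    test : Word → ℕ → ℕ → Bool
    test w p q = (p + m <ᵇ suc q) ∧ orderIsoᵇ (take m (drop p w) ++ take 1 (drop q w)) (α ++ b ∷ [])

  T-occursᵇ⇔indexed : ∀ w → T (occursᵇ α b w) ⇔ (∃[ p ] ∃[ q ] q < length w × IndexedMatch α b w p q)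
  T-occursᵇ⇔indexed w = mk⇔ to from
    where
    n : ℕ
    n = length w
    to : T (occursᵇ α b w) → ∃[ p ] ∃[ q ] q < n × IndexedMatch α b w p q
    to t with Equivalence.to (T-any-upTo (λ p → any (test w p) (upTo n)) n) t
    ... | p , _ , tp with Equivalence.to (T-any-upTo (test w p) n) tp
    ... | q , q<n , tpq with Equivalence.to T-∧ tpq
    ... | pm<1+q , iso = p , q , q<n , s≤s⁻¹ (<ᵇ⇒< _ _ pm<1+q) , Equivalence.to (T-orderIsoᵇ⇔ _ _) iso
    from : (∃[ p ] ∃[ q ] q < n × IndexedMatch α b w p q) → T (occursᵇ α b w)
    from (p , q , q<n , pm≤q , iso) =
      Equivalence.from (T-any-upTo (λ p → any (test w p) (upTo n)) n)
        (p , p<n , Equivalence.from (T-any-upTo (test w p) n)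
          (q , q<n , Equivalence.from T-∧ (<⇒<ᵇ (s≤s pm≤q) , Equivalence.from (T-orderIsoᵇ⇔ _ _) iso)))
      where
      p<n : p < n
      p<n = ≤-<-trans (≤-trans (m≤m+n p m) pm≤q) q<n

  indexedMatch⇒match : ∀ w {p q} → q < length w → IndexedMatch α b w p q → VincularMatch α b (drop p w)
  indexedMatch⇒match w {p} {q} q<n (pm≤q , iso) with drop-<-length q w q<n
  ... | v , post , drop-q =
    vincularMatch split (subst (λ z → reduce (take m (drop p w) ++ take 1 z) ≡ _) drop-q iso)
    where
    d : ℕ
    d = q ∸ (p + m)
    u : Word
    u = take m (drop p w)
    split : drop p w ≡ u ++ take d (drop (p + m) w) ++ v ∷ post
    split = begin
      drop p w                                           ≡⟨ take++drop≡id m (drop p w) ⟨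
      u ++ drop m (drop p w)                             ≡⟨ cong (u ++_) (drop-drop p m w) ⟩
      u ++ drop (p + m) w                                ≡⟨ cong (u ++_) (take++drop≡id d (drop (p + m) w)) ⟨
      u ++ take d (drop (p + m) w) ++ drop d (drop (p + m) w)
        ≡⟨ cong (λ z → u ++ take d (drop (p + m) w) ++ z) (drop-drop (p + m) d w) ⟩
      u ++ take d (drop (p + m) w) ++ drop (p + m + d) w
        ≡⟨ cong (λ i → u ++ take d (drop (p + m) w) ++ drop i w) (m+[n∸m]≡n pm≤q) ⟩
      u ++ take d (drop (p + m) w) ++ drop q w
        ≡⟨ cong (λ z → u ++ take d (drop (p + m) w) ++ z) drop-q ⟩
      u ++ take d (drop (p + m) w) ++ v ∷ post           ∎
      where open ≡-Reasoning

  match⇒indexedMatch : ∀ w p → VincularMatch α b (drop p w) →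
                       ∃[ q ] q < length w × IndexedMatch α b w p q
  match⇒indexedMatch w p (vincularMatch {u} {mid} {post} {v} split iso) =
    q , drop≡∷⇒< q w drop-q , pm≤q ,
    subst₂ (λ x y → reduce (x ++ take 1 y) ≡ _) (sym take-m) (sym drop-q) iso
    where
    open ≡-Reasoning
    |u|≡m : length u ≡ m
    |u|≡m = +-cancelʳ-≡ 1 _ _ (begin
      length u + 1              ≡⟨ length-++ u ⟨
      length (u ++ v ∷ [])      ≡⟨ length-map _ (u ++ v ∷ []) ⟨
      length (reduce (u ++ v ∷ [])) ≡⟨ cong length iso ⟩
      length (reduce (α ++ b ∷ [])) ≡⟨ length-map _ (α ++ b ∷ []) ⟩
      length (α ++ b ∷ [])      ≡⟨ length-++ α ⟩
      m + 1                     ∎)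
    q : ℕ
    q = p + (length u + length mid)
    pm≤q : p + m ≤ q
    pm≤q = subst (λ k → p + k ≤ q) |u|≡m (+-monoʳ-≤ p (m≤m+n _ _))
    take-m : take m (drop p w) ≡ u
    take-m = trans (cong₂ take (sym |u|≡m) split) (take-length-++ u)
    drop-q : drop q w ≡ v ∷ post
    drop-q = begin
      drop (p + (length u + length mid)) w                    ≡⟨ drop-drop p _ w ⟨
      drop (length u + length mid) (drop p w)                 ≡⟨ cong (drop (length u + length mid)) split ⟩
      drop (length u + length mid) (u ++ mid ++ v ∷ post)     ≡⟨ drop-drop (length u) (length mid) _ ⟨
      drop (length mid) (drop (length u) (u ++ mid ++ v ∷ post))
                                                              ≡⟨ cong (drop (length mid)) (drop-length-++ u) ⟩
      drop (length mid) (mid ++ v ∷ post)                     ≡⟨ drop-length-++ mid ⟩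
      v ∷ post                                                ∎

  T-occursᵇ⇔matches : ∀ w → T (occursᵇ α b w) ⇔ Any (VincularMatch α b) (tails w)
  T-occursᵇ⇔matches w = mk⇔
    (λ t → let p , q , q<n , witness = Equivalence.to (T-occursᵇ⇔indexed w) t
           in Any-tails⁺ p w (indexedMatch⇒match w q<n witness))
    (λ any → let p , match = Any-tails⁻ w any
                 q , q<n , witness = match⇒indexedMatch w p match
             in Equivalence.from (T-occursᵇ⇔indexed w) (p , q , q<n , witness))

record LeadingMatch (pat : ℕ → ℕ → Word) (s : Word) : Set where
  constructor leadingMatch
  field
    {low high between} : ℕ
    {middle rest}      : Word
    shape              : s ≡ pat low high ++ middle ++ between ∷ rest
    low<between        : low < between
    between<high       : between < high

module _ {t : List Bool} (low : false ∈ t) (high : true ∈ t)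
         (pat : ℕ → ℕ → Word) (pat≡ : ∀ a c → pat a c ≡ instantiate a c t) where

  private
    reduce-pat : ∀ {a b c} → a < b → b < c → reduce (pat a c ++ b ∷ []) ≡ instantiate 1 3 t ++ 2 ∷ []
    reduce-pat {a} {b} {c} a<b b<c =
      trans (cong (λ x → reduce (x ++ b ∷ [])) (pat≡ a c)) (reduce-instantiate low a<b b<c)

  VincularMatch⇔LeadingMatch : ∀ s → VincularMatch (pat 1 3) 2 s ⇔ LeadingMatch pat s
  VincularMatch⇔LeadingMatch s = mk⇔ to from
    where
    to : VincularMatch (pat 1 3) 2 s → LeadingMatch pat s
    to (vincularMatch {u} {mid} {post} {v} split iso)
      with reduce≡instantiate⁻ low high u v (trans iso (reduce-pat (n<1+n 1) (n<1+n 2)))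
    ... | a , c , u≡ , a<v , v<c =
      leadingMatch (trans split (cong (_++ mid ++ v ∷ post) (trans u≡ (sym (pat≡ a c))))) a<v v<c
    from : LeadingMatch pat s → VincularMatch (pat 1 3) 2 s
    from (leadingMatch shape a<b b<c) =
      vincularMatch shape (trans (reduce-pat a<b b<c) (sym (reduce-pat (n<1+n 1) (n<1+n 2))))

patternA : ℕ → ℕ → ℕ → Word
patternA i a c = replicate i a ++ c ∷ []

patternB : ℕ → ℕ → ℕ → Word
patternB i a c = a ∷ replicate i c

patternA-instantiate : ∀ i a c → patternA i a c ≡ instantiate a c (replicate i false ++ true ∷ [])
patternA-instantiate i a c = sym (trans (map-++ _ (replicate i false) (true ∷ []))
                                        (cong (_++ c ∷ []) (map-replicate _ i false)))

patternB-instantiate : ∀ i a c → patternB i a c ≡ instantiate a c (false ∷ replicate i true)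
patternB-instantiate i a c = sym (cong (a ∷_) (map-replicate _ i true))

T-occursᵇ-A⇔ : ∀ i w → T (occursᵇ (patternA (suc i) 1 3) 2 w) ⇔
                       Any (LeadingMatch (patternA (suc i))) (tails w)
T-occursᵇ-A⇔ i w = ⇔-trans (T-occursᵇ⇔matches (patternA (suc i) 1 3) 2 w)
  (Any-⇔ (VincularMatch⇔LeadingMatch (here refl) (∈-++⁺ʳ (replicate (suc i) false) (here refl))
                                     (patternA (suc i)) (patternA-instantiate (suc i))))

T-occursᵇ-B⇔ : ∀ i w → T (occursᵇ (patternB (suc i) 1 3) 2 w) ⇔
                       Any (LeadingMatch (patternB (suc i))) (tails w)
T-occursᵇ-B⇔ i w = ⇔-trans (T-occursᵇ⇔matches (patternB (suc i) 1 3) 2 w)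
  (Any-⇔ (VincularMatch⇔LeadingMatch (here refl) (there (here refl))
                                     (patternB (suc i)) (patternB-instantiate (suc i))))

-- Occurrences read off the runs

replicate-++-prefix : ∀ i m {c y : ℕ} {X D : Word} → head D ≢ just y →
                      replicate (suc i) c ++ X ≡ replicate (suc m) y ++ D →
                      c ≡ y × i ≤ m × X ≡ replicate (m ∸ i) y ++ D
replicate-++-prefix zero    m                h eq = ∷-injectiveˡ eq , z≤n , ∷-injectiveʳ eq
replicate-++-prefix (suc i) zero    {D = d ∷ D} h eq =
  ⊥-elim (h (cong just (trans (sym (∷-injectiveˡ (∷-injectiveʳ eq))) (∷-injectiveˡ eq))))
replicate-++-prefix (suc i) (suc m)          h eq with replicate-++-prefix i m h (∷-injectiveʳ eq)
... | c≡y , i≤m , X≡ = c≡y , s≤s i≤m , X≡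

head-decode : ∀ {z} R → Linked _≢_ (z ∷ letters R) → head (decode R) ≢ just z
head-decode []            _         ()
head-decode ((w , t) ∷ R) (z≢w ∷ _) refl = z≢w refl

LeadingMatch-nonconstant : ∀ {pat y s} → (∀ a c → c ∈ pat a c) → All (_≡ y) s → ¬ LeadingMatch pat s
LeadingMatch-nonconstant {pat} {y} c∈pat all (leadingMatch {a} {c} {b} {mid} {post} shape _ b<c) =
  <-irrefl (trans (letter (∈-++⁺ʳ (pat a c) (∈-++⁺ʳ mid (here refl))))
                  (sym (letter (∈-++⁺ˡ (c∈pat a c)))))
           b<c
  where
  letter : ∀ {x} → x ∈ pat a c ++ mid ++ b ∷ post → x ≡ y
  letter x∈ = All.lookup all (subst (_ ∈_) (sym shape) x∈)

Any-tails-constant : ∀ {pat y} → (∀ a c → c ∈ pat a c) →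
                     ∀ {s} → All (_≡ y) s → ¬ Any (LeadingMatch pat) (tails s)
Any-tails-constant c∈pat {s} all any =
  let p , match = Any-tails⁻ s any in LeadingMatch-nonconstant c∈pat (Allₚ.drop⁺ p all) match

Separated : ℕ → ℕ → List ℕ → Set
Separated y z ys = ∃[ b ] b ∈ ys × y < b × b < z

-- rs is aligned with the first letter of each adjacent pair in ys. Aligning the run lengths with
-- the first or with the second run of each pair gives the criteria for 1ⁱ3-2 and 13ⁱ-2.
SeparatedAscent : ℕ → List ℕ → List ℕ → Set
SeparatedAscent i (y ∷ z ∷ ys) (r ∷ rs) = (i ≤ suc r × Separated y z ys) ⊎ SeparatedAscent i (z ∷ ys) rs
SeparatedAscent i _            _        = ⊥

module _ (i : ℕ) {y r z s : ℕ} {R : Runs} (maximal : Maximal ((y , r) ∷ (z , s) ∷ R)) where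

  private
    D : Word
    D = decode ((z , s) ∷ R)
    y≢z : y ≢ z
    y≢z = Linked.head maximal
    head-D : head D ≢ just y
    head-D eq = y≢z (sym (just-injective eq))
    head-R : head (decode R) ≢ just z
    head-R = head-decode R (Linked.tail maximal)

  -- The block aⁱ⁺¹c of an occurrence starting in the first run must end where that run ends
  -- (as c ≠ a), so a = y, c = z and b, being neither, is a letter of a later run.
  firstRun-A⇔ : (∃[ j ] j ≤ r × LeadingMatch (patternA (suc i)) (replicate (suc j) y ++ D)) ⇔
                (suc i ≤ suc r × Separated y z (letters R))
  firstRun-A⇔ = mk⇔ to from
    where
    to : (∃[ j ] j ≤ r × LeadingMatch (patternA (suc i)) (replicate (suc j) y ++ D)) →
         suc i ≤ suc r × Separated y z (letters R)
    to (j , j≤r , leadingMatch {a} {c} {b} {mid} {post} shape a<b b<c)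
      with replicate-++-prefix i j head-D (sym (trans shape (++-assoc (replicate (suc i) a) (c ∷ []) _)))
    ... | refl , i≤j , X≡ = s≤s (≤-trans i≤j j≤r) , after-run (j ∸ i) X≡
      where
      after-run : ∀ d → c ∷ mid ++ b ∷ post ≡ replicate d a ++ D → Separated a z (letters R)
      after-run zero    eq with refl ← ∷-injectiveˡ eq =
        b , ∈-decode⁻ R (∈-replicate-++⁻ s (subst (b ∈_) (∷-injectiveʳ eq) (∈-++⁺ʳ mid (here refl)))
                                           (<⇒≢ b<c))
          , a<b , b<c
      after-run (suc d) eq = ⊥-elim (<⇒≢ (<-trans a<b b<c) (sym (∷-injectiveˡ eq)))
    from : suc i ≤ suc r × Separated y z (letters R) →
           ∃[ j ] j ≤ r × LeadingMatch (patternA (suc i)) (replicate (suc j) y ++ D)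
    from (s≤s i≤r , b , b∈ , y<b , b<z) with ∈-∃++ (∈-decode⁺ R b∈)
    ... | mid , post , R≡ = i , i≤r , leadingMatch shape y<b b<z
      where
      shape : replicate (suc i) y ++ D ≡ patternA (suc i) y z ++ (replicate s z ++ mid) ++ b ∷ post
      shape = begin
        replicate (suc i) y ++ z ∷ replicate s z ++ decode R
          ≡⟨ cong (λ X → replicate (suc i) y ++ z ∷ replicate s z ++ X) R≡ ⟩
        replicate (suc i) y ++ z ∷ replicate s z ++ mid ++ b ∷ post
          ≡⟨ cong (λ X → replicate (suc i) y ++ z ∷ X) (++-assoc (replicate s z) mid _) ⟨
        replicate (suc i) y ++ (z ∷ []) ++ (replicate s z ++ mid) ++ b ∷ post
          ≡⟨ ++-assoc (replicate (suc i) y) (z ∷ []) _ ⟨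
        patternA (suc i) y z ++ (replicate s z ++ mid) ++ b ∷ post
          ∎
        where open ≡-Reasoning

  -- The block acⁱ⁺¹ of an occurrence starting in the first run must start at its last letter
  -- (as c ≠ a), so a = y and cⁱ⁺¹ is a prefix of the run of z.
  firstRun-B⇔ : (∃[ j ] j ≤ r × LeadingMatch (patternB (suc i)) (replicate (suc j) y ++ D)) ⇔
                (suc i ≤ suc s × Separated y z (letters R))
  firstRun-B⇔ = mk⇔ to from
    where
    to : (∃[ j ] j ≤ r × LeadingMatch (patternB (suc i)) (replicate (suc j) y ++ D)) →
         suc i ≤ suc s × Separated y z (letters R)
    to (suc j , _ , leadingMatch shape a<b b<c) =
      ⊥-elim (<⇒≢ (<-trans a<b b<c) (trans (sym (∷-injectiveˡ shape)) (∷-injectiveˡ (∷-injectiveʳ shape))))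
    to (zero , _ , leadingMatch {a} {c} {b} {mid} {post} shape a<b b<c)
      with refl ← ∷-injectiveˡ shape
      with replicate-++-prefix i s head-R (sym (∷-injectiveʳ shape))
    ... | refl , i≤s , X≡ =
      s≤s i≤s , b , ∈-decode⁻ R (∈-replicate-++⁻ (s ∸ i) (subst (b ∈_) X≡ (∈-++⁺ʳ mid (here refl)))
                                                   (<⇒≢ b<c))
              , a<b , b<c
    from : suc i ≤ suc s × Separated y z (letters R) →
           ∃[ j ] j ≤ r × LeadingMatch (patternB (suc i)) (replicate (suc j) y ++ D)
    from (s≤s i≤s , b , b∈ , y<b , b<z) with ∈-∃++ (∈-decode⁺ R b∈)
    ... | mid , post , R≡ = 0 , z≤n , leadingMatch shape y<b b<z
      where
      shape : y ∷ D ≡ patternB (suc i) y z ++ (replicate (s ∸ i) z ++ mid) ++ b ∷ post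
      shape = cong (y ∷_) (begin
        replicate (suc s) z ++ decode R
          ≡⟨ cong (λ n → replicate (suc n) z ++ decode R) (m+[n∸m]≡n i≤s) ⟨
        replicate (suc i + (s ∸ i)) z ++ decode R
          ≡⟨ cong (_++ decode R) (replicate-+ (suc i) (s ∸ i) z) ⟩
        (replicate (suc i) z ++ replicate (s ∸ i) z) ++ decode R
          ≡⟨ ++-assoc (replicate (suc i) z) _ _ ⟩
        replicate (suc i) z ++ replicate (s ∸ i) z ++ decode R
          ≡⟨ cong (λ X → replicate (suc i) z ++ replicate (s ∸ i) z ++ X) R≡ ⟩
        replicate (suc i) z ++ replicate (s ∸ i) z ++ mid ++ b ∷ post
          ≡⟨ cong (replicate (suc i) z ++_) (++-assoc (replicate (s ∸ i) z) mid _) ⟨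
        replicate (suc i) z ++ (replicate (s ∸ i) z ++ mid) ++ b ∷ post
          ∎)
        where open ≡-Reasoning

module _ (i : ℕ) where

  private
    last∈A : ∀ a c → c ∈ patternA (suc i) a c
    last∈A a c = ∈-++⁺ʳ (replicate (suc i) a) (here refl)
    last∈B : ∀ a c → c ∈ patternB (suc i) a c
    last∈B a c = there (here refl)
    constant-run : ∀ {y} r → All (_≡ y) (decode ((y , r) ∷ []))
    constant-run r = Allₚ.++⁺ (Allₚ.replicate⁺ (suc r) refl) []

  occurs-A⇔ : ∀ R → Maximal R →
              Any (LeadingMatch (patternA (suc i))) (tails (decode R)) ⇔
              SeparatedAscent (suc i) (letters R) (lengths R)
  occurs-A⇔ []                      _       = mk⇔ (Any-tails-constant {y = 0} last∈A []) λ ()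
  occurs-A⇔ ((y , r) ∷ [])          _       = mk⇔ (Any-tails-constant last∈A (constant-run r)) λ ()
  occurs-A⇔ ((y , r) ∷ (z , s) ∷ R) maximal =
    ⇔-trans (Any-tails-replicate-++⇔ r {y} {decode ((z , s) ∷ R)})
            (firstRun-A⇔ i {y} {r} {z} {s} {R} maximal ⊎-⇔ occurs-A⇔ ((z , s) ∷ R) (Linked.tail maximal))

  occurs-B⇔ : ∀ R → Maximal R →
              Any (LeadingMatch (patternB (suc i))) (tails (decode R)) ⇔
              SeparatedAscent (suc i) (letters R) (drop 1 (lengths R))
  occurs-B⇔ []                      _       = mk⇔ (Any-tails-constant {y = 0} last∈B []) λ ()
  occurs-B⇔ ((y , r) ∷ [])          _       = mk⇔ (Any-tails-constant last∈B (constant-run r)) λ ()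
  occurs-B⇔ ((y , r) ∷ (z , s) ∷ R) maximal =
    ⇔-trans (Any-tails-replicate-++⇔ r {y} {decode ((z , s) ∷ R)})
            (firstRun-B⇔ i {y} {r} {z} {s} {R} maximal ⊎-⇔ occurs-B⇔ ((z , s) ∷ R) (Linked.tail maximal))

SeparatedAscent-++ : ∀ i ys rs es → length ys ≤ suc (length rs) →
                     SeparatedAscent i ys (rs ++ es) ≡ SeparatedAscent i ys rs
SeparatedAscent-++ i []           rs       es _       = refl
SeparatedAscent-++ i (y ∷ [])     rs       es _       = refl
SeparatedAscent-++ i (y ∷ z ∷ ys) (r ∷ rs) es (s≤s l) =
  cong (_ ⊎_) (SeparatedAscent-++ i (z ∷ ys) rs es l)

SeparatedAscent-rotateˡ : ∀ i R → SeparatedAscent i (letters R) (rotateˡ (lengths R)) ≡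
                                  SeparatedAscent i (letters R) (drop 1 (lengths R))
SeparatedAscent-rotateˡ i []            = refl
SeparatedAscent-rotateˡ i ((y , r) ∷ R) =
  SeparatedAscent-++ i (y ∷ letters R) (lengths R) (r ∷ []) (s≤s (≤-reflexive (length-letters R)))

-- Rotating the run lengths

T-occursᵇ-B⇔T-occursᵇ-A-rotate : ∀ i w → T (occursᵇ (patternB (suc i) 1 3) 2 w) ⇔
                                       T (occursᵇ (patternA (suc i) 1 3) 2 (relengthWord rotateˡ w))
T-occursᵇ-B⇔T-occursᵇ-A-rotate i w = begin
  T (occursᵇ (patternB (suc i) 1 3) 2 w)                     ≈⟨ T-occursᵇ-B⇔ i w ⟩
  Any (LeadingMatch (patternB (suc i))) (tails w)            ≡⟨ cong (Any _ ∘ tails) (decode-encode w) ⟨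
  Any (LeadingMatch (patternB (suc i))) (tails (decode R))   ≈⟨ occurs-B⇔ i R (encode-maximal w) ⟩
  SeparatedAscent (suc i) (letters R) (drop 1 (lengths R))   ≡⟨ SeparatedAscent-rotateˡ (suc i) R ⟨
  SeparatedAscent (suc i) (letters R) (rotateˡ (lengths R))
    ≡⟨ cong₂ (SeparatedAscent (suc i)) (letters-relength R) (lengths-relength R) ⟨
  SeparatedAscent (suc i) (letters R′) (lengths R′)          ≈⟨ occurs-A⇔ i R′ (relength-encode-maximal w) ⟨
  Any (LeadingMatch (patternA (suc i))) (tails (decode R′))  ≈⟨ T-occursᵇ-A⇔ i (decode R′) ⟨
  T (occursᵇ (patternA (suc i) 1 3) 2 (decode R′))           ∎
  where
  R R′ : Runs
  R = encode w
  R′ = relength rotateˡ R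
  open PermutedLengths rotateˡ rotateˡ-↭
  open SetoidReasoning (⇔-setoid 0ℓ)

patterns-wilfEquivalent : ∀ i → WilfEquivalent (patternA (suc i) 1 3) 2 (patternB (suc i) 1 3) 2
patterns-wilfEquivalent i n k _ =
  sym (length-filterᵇ-bijection (words n k) (words-unique n k) rotate rotate⁻¹
         (relengthWord-inverse rotateˡ rotateʳ rotateˡ-↭ rotateʳ-rotateˡ)
         (relengthWord-inverse rotateʳ rotateˡ rotateʳ-↭ rotateˡ-rotateʳ)
         (words-closed rotate Left.length-relengthWord Left.All-relengthWord n k)
         (words-closed rotate⁻¹ Right.length-relengthWord Right.All-relengthWord n k)
         (avoidsᵇ (patternB (suc i) 1 3) 2) (avoidsᵇ (patternA (suc i) 1 3) 2)
         (λ w → cong not (T-⇔⇒≡ (T-occursᵇ-B⇔T-occursᵇ-A-rotate i w))))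
  where
  rotate rotate⁻¹ : Word → Word
  rotate = relengthWord rotateˡ
  rotate⁻¹ = relengthWord rotateʳ
  module Left = PermutedLengths rotateˡ rotateˡ-↭
  module Right = PermutedLengths rotateʳ rotateʳ-↭

-- The argument works for every i ≥ 1; the hypothesis 2 ≤ i is used only to exclude i = 0.
theorem3p1 : (i : ℕ) → 2 ≤ i →
    WilfEquivalent (replicate i 1 ++ 3 ∷ []) 2 (1 ∷ replicate i 3) 2
theorem3p1 (suc i) _ = patterns-wilfEquivalent i
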